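{- Let $S$ be a string of length $n$ in which every character occurs at least twice, let $\sigma$ be a character of $S$ occurring $\ell\ge 2$ times, at positions $i_1<\dots<i_\ell$, and let $e=\lfloor \ell/2\rfloor$. Let $Y$ be any maximal common subsequence of $S[i_1,i_{e+1})$ and $S[i_{e+1},n]$ containing $\sigma^e$; if $\ell$ is odd and $Y$ is a subsequence of $S[i_{e+2},n]$, replace $Y$ by any maximal common subsequence of $S[i_1,i_{e+2})$ and $S[i_{e+2},n]$ containing the old $Y$. Let $j_1$ be the smallest index such that $Y$ is a subsequence of $S[i_1,j_1]$, and let $Z$ be any maximal common subsequence of $S[1,j_1]$ and $S(j_1,n]$ containing $Y$. If $\ell$ is odd, let $j_2$ be the smallest index such that $Y$ is a subsequence of $S[i_2,j_2]$, and if moreover $Z$ is a subsequence of $S(j_2,n]$, replace $Z$ by any maximal common subsequence of $S[1,j_2]$ and $S(j_2,n]$ containing the old $Z$. Then $X_2=ZZ$ is not left-extendable.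
   Context: For a string $S$, $S[i,j]=S[i]\cdots S[j]$ (empty if $j<i$), $S[i,j)=S[i,j-1]$, $S(i,j]=S[i+1,j]$; $\sigma^e$ is $e$ copies of $\sigma$. A common subsequence $C$ of $S_1,S_2$ is maximal if no common subsequence of $S_1,S_2$ properly contains it. A square subsequence $WW$ of $S$ is left-extendable if there is a character $y$ such that $yWyW$ is a subsequence of $S$. -}

module Defs where

open import Data.Nat using (ℕ; zero; suc; _∸_; _≤_; _<_; _+_)
open import Data.List using (List; []; _∷_; _++_; take; drop; length; replicate)
open import Data.Maybe using (Maybe; just; nothing)
open import Data.Product using (_×_; ∃-syntax)
open import Relation.Binary.PropositionalEquality using (_≡_)
open import Data.List.Relation.Binary.Sublist.Propositional using (_⊆_)

Subseq : {A : Set} → List A → List A → Set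
Subseq C S = C ⊆ S

-- 1-indexed character access: at S p = just S[p] for 1 ≤ p ≤ |S|.
at : {A : Set} → List A → ℕ → Maybe A
at []       _             = nothing
at (x ∷ xs) zero          = nothing
at (x ∷ xs) (suc zero)    = just x
at (x ∷ xs) (suc (suc k)) = at xs (suc k)

-- S[i,j] = S[i] ⋯ S[j]  (1-indexed, empty if j < i)
seg : {A : Set} → List A → ℕ → ℕ → List A
seg S i j = take (suc j ∸ i) (drop (i ∸ 1) S)

-- S[i,j) = S[i,j-1]
segCO : {A : Set} → List A → ℕ → ℕ → List A
segCO S i j = take (j ∸ i) (drop (i ∸ 1) S)

segOC : {A : Set} → List A → ℕ → ℕ → List A
segOC S i j = seg S (suc i) j

CommonSubseq : {A : Set} → List A → List A → List A → Set
CommonSubseq S₁ S₂ C = Subseq C S₁ × Subseq C S₂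

MaxCommonSubseq : {A : Set} → List A → List A → List A → Set
MaxCommonSubseq S₁ S₂ C =
  CommonSubseq S₁ S₂ C ×
  (∀ C' → CommonSubseq S₁ S₂ C' → Subseq C C' → C' ≡ C)

LeftExtendable : {A : Set} → List A → List A → Set
LeftExtendable S W = ∃[ y ] Subseq ((y ∷ W) ++ (y ∷ W)) S

SmallestEnd : {A : Set} → List A → ℕ → List A → ℕ → Set
SmallestEnd S i C j = Subseq C (seg S i j) × (∀ j' → j' < j → Subseq C (seg S i j') → Data.Empty.⊥)
  where import Data.Empty

{-# OPTIONS --safe #-}
-- Suppose yZyZ is a subsequence of S, and cut S = P ++ Q between the two copies of yZ.  Each copy
-- contains σᵉ ⊆ Y ⊆ Z and S contains ℓ ≤ 2e + 1 σ's, so P contains e of them, or e + 1 when ℓ is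
-- odd, and at most one σ of P (only when ℓ is odd) precedes the one matched by the first σ of Z.
-- Y must begin with σ, since its window holds too few σ's otherwise, so Y ⊆ σZ″, the suffix of Z
-- from its first σ.  σZ″ is a common subsequence of the two sides of the split at the first σ after
-- P, which is i_{e+1} (or i_{e+2}), so maximality of Y forces Y = σZ″.  Then the smallest j₁ (or j₂)
-- lies inside P, and yZ is a common subsequence of S[1,j] and S(j,n] properly containing Z₀ (or Z),
-- contradicting maximality.
module Submission where

open import Defs
open import Data.Nat using (ℕ; zero; suc; pred; _+_; _∸_; _≤_; _<_; z≤n; s≤s; >-nonZero)
open import Data.Nat.DivMod using (_/_; _%_; m≡m%n+[m/n]*n; m%n<n)
open import Data.Nat.Properties
open import Data.List using (List; []; _∷_; _++_; take; drop; length; replicate)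
open import Data.List.Properties using (take-all; length-drop; take++drop≡id; ++-assoc)
open import Data.List.Relation.Binary.Sublist.Propositional
  using (_⊆_; []; _∷_; _∷ʳ_; ⊆-refl; ⊆-trans; ⊆-antisym; ⊆-reflexive)
open import Data.List.Relation.Binary.Sublist.Propositional.Properties
  using (++⁺; ++⁺ˡ; ++⁺ʳ; length-mono-≤; take⁺; ∷ˡ⁻)
open import Data.List.Relation.Unary.All using (All; []; _∷_; tabulate)
open import Data.List.Relation.Unary.Any using (here; there)
open import Data.List.Membership.Propositional using (_∈_)
open import Data.Maybe using (just)
open import Data.Product using (_×_; _,_; proj₁; proj₂; ∃-syntax; ∃₂)
open import Data.Sum using (_⊎_; inj₁; inj₂)
open import Relation.Nullary using (¬_; Dec; yes; no; contradiction)
open import Relation.Nullary.Decidable using (¬¬-excluded-middle)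
open import Function using (case_of_)
open import Relation.Binary.PropositionalEquality
  using (_≡_; _≢_; refl; sym; trans; cong; cong₂; subst; subst₂)

module _ {A : Set} where

  ++-⊆-split : ∀ xs {ys zs : List A} → (xs ++ ys) ⊆ zs →
               ∃₂ λ us vs → zs ≡ us ++ vs × xs ⊆ us × ys ⊆ vs
  ++-⊆-split []       xs⊆zs = [] , _ , refl , [] , xs⊆zs
  ++-⊆-split (x ∷ xs) (z ∷ʳ p) with ++-⊆-split (x ∷ xs) p
  ... | us , vs , refl , q , r = z ∷ us , vs , refl , z ∷ʳ q , r
  ++-⊆-split (x ∷ xs) (refl ∷ p) with ++-⊆-split xs p
  ... | us , vs , refl , q , r = x ∷ us , vs , refl , refl ∷ q , r

  ∷-⊆-split : ∀ {x : A} {xs zs} → (x ∷ xs) ⊆ zs →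
              ∃₂ λ us vs → zs ≡ us ++ x ∷ vs × xs ⊆ vs
  ∷-⊆-split (z ∷ʳ p) with ∷-⊆-split p
  ... | us , vs , refl , q = z ∷ us , vs , refl , q
  ∷-⊆-split (refl ∷ p) = [] , _ , refl , p

  ++∷-⊆-split : ∀ xs {x : A} {ys zs} → (xs ++ x ∷ ys) ⊆ zs →
                ∃₂ λ us vs → zs ≡ us ++ x ∷ vs × xs ⊆ us × ys ⊆ vs
  ++∷-⊆-split xs p with ++-⊆-split xs p
  ... | us , ws , refl , xs⊆us , q with ∷-⊆-split q
  ... | us′ , vs , refl , ys⊆vs =
    us ++ us′ , vs , sym (++-assoc us us′ _) , ++⁺ʳ us′ xs⊆us , ys⊆vs

  take-++-length : ∀ (xs ys : List A) → take (length xs) (xs ++ ys) ≡ xs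
  take-++-length []       ys = refl
  take-++-length (x ∷ xs) ys = cong (x ∷_) (take-++-length xs ys)

  drop-++-length : ∀ (xs ys : List A) → drop (length xs) (xs ++ ys) ≡ ys
  drop-++-length []       ys = refl
  drop-++-length (x ∷ xs) ys = drop-++-length xs ys

  take-++-≥ : ∀ m (xs ys : List A) → length xs ≤ m →
              take m (xs ++ ys) ≡ xs ++ take (m ∸ length xs) ys
  take-++-≥ m       []       ys _         = refl
  take-++-≥ (suc m) (x ∷ xs) ys (s≤s le) = cong (x ∷_) (take-++-≥ m xs ys le)

  take-through : ∀ a {b} {x : A} {xs ys} → drop a xs ≡ x ∷ ys → a < b →
                 take b xs ≡ take a xs ++ x ∷ take (b ∸ suc a) ys
  take-through zero    {suc b} refl       _         = refl
  take-through (suc a) {suc b} {xs = z ∷ xs} eq (s≤s a<b) = cong (z ∷_) (take-through a eq a<b)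

  slice-through : ∀ a {b} {x : A} {xs ys} → drop a xs ≡ x ∷ ys → a < b →
                  take (b ∸ a) (drop a xs) ≡ x ∷ take (b ∸ suc a) ys
  slice-through zero    {suc b} refl       _         = refl
  slice-through (suc a) {suc b} {xs = z ∷ xs} eq (s≤s a<b) = slice-through a eq a<b

  ⊆-drop-++ : ∀ m (xs : List A) {ys} → m ≤ length xs → ys ⊆ drop m (xs ++ ys)
  ⊆-drop-++ zero    xs       _        = ++⁺ˡ xs ⊆-refl
  ⊆-drop-++ (suc m) (x ∷ xs) (s≤s le) = ⊆-drop-++ m xs le

  ⊆-slice : ∀ m n (xs ys zs : List A) → m ≤ length xs → length (xs ++ ys) ≤ n →
            ys ⊆ take (n ∸ m) (drop m (xs ++ ys ++ zs))
  ⊆-slice zero    n       []       ys zs _        le       =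
    subst (ys ⊆_) (sym (take-++-≥ n ys zs le)) (++⁺ʳ _ ⊆-refl)
  ⊆-slice zero    (suc n) (x ∷ xs) ys zs _        (s≤s le) = x ∷ʳ ⊆-slice 0 n xs ys zs z≤n le
  ⊆-slice (suc m) (suc n) (x ∷ xs) ys zs (s≤s m≤) (s≤s le) = ⊆-slice m n xs ys zs m≤ le

  seg-to-end : ∀ (xs : List A) m → seg xs (suc m) (length xs) ≡ drop m xs
  seg-to-end xs m = take-all (length xs ∸ m) (drop m xs) (≤-reflexive (length-drop m xs))

  at-zero : ∀ (xs : List A) {x} → at xs 0 ≢ just x
  at-zero []       ()
  at-zero (_ ∷ _) ()

  at-drop : ∀ (xs : List A) q {x} → at xs (suc q) ≡ just x → drop q xs ≡ x ∷ drop (suc q) xs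
  at-drop (y ∷ xs) zero    refl = refl
  at-drop (y ∷ xs) (suc q) eq   = at-drop xs q eq

  at-++-length : ∀ (xs : List A) {x ys} → at (xs ++ x ∷ ys) (suc (length xs)) ≡ just x
  at-++-length []           = refl
  at-++-length (_ ∷ [])     = refl
  at-++-length (_ ∷ y ∷ xs) = at-++-length (y ∷ xs)

  ∈-slice⇒at : ∀ a d (xs : List A) {x} → x ∈ take d (drop a xs) →
               ∃[ q ] (q < d × at xs (suc (a + q)) ≡ just x)
  ∈-slice⇒at a       zero    xs       ()
  ∈-slice⇒at zero    (suc d) []       ()
  ∈-slice⇒at (suc a) (suc d) []       ()
  ∈-slice⇒at (suc a) (suc d) (y ∷ xs) x∈          = ∈-slice⇒at a (suc d) xs x∈
  ∈-slice⇒at zero    (suc d) (y ∷ xs) (here refl) = 0 , s≤s z≤n , refl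
  ∈-slice⇒at zero    (suc d) (y ∷ xs) (there x∈) with ∈-slice⇒at zero d xs x∈
  ... | q , q<d , at≡ = suc q , s≤s q<d , at≡

  SmallestEnd-split : ∀ us vs ws {x : A} {C D j} → C ⊆ us → D ⊆ vs → (C ++ x ∷ D) ⊆ ws →
    let T = us ++ (x ∷ vs) ++ ws in
    SmallestEnd T (suc (length us)) (x ∷ D) j →
    CommonSubseq (seg T 1 j) (segOC T j (length T)) (C ++ x ∷ D)
  SmallestEnd-split us vs ws {x} {C} {D} {j} C⊆us D⊆vs CxD⊆ws (xD⊆ , minimal) = left , right
    where
      T = us ++ (x ∷ vs) ++ ws

      us≤j : length us ≤ j
      us≤j = <⇒≤ (m∸n≢0⇒n<m λ j∸us≡0 →
               ∷⊈[] (subst (λ d → (x ∷ D) ⊆ take d (drop (length us) T)) j∸us≡0 xD⊆))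
        where ∷⊈[] : ¬ (x ∷ D) ⊆ []
              ∷⊈[] ()

      j≤ : j ≤ length (us ++ x ∷ vs)
      j≤ = ≮⇒≥ λ j> → minimal _ j>
             (⊆-trans (refl ∷ D⊆vs) (⊆-slice _ _ us (x ∷ vs) ws ≤-refl ≤-refl))

      left : (C ++ x ∷ D) ⊆ take j T
      left = subst ((C ++ x ∷ D) ⊆_) (sym (take-++-≥ j us _ us≤j))
               (++⁺ C⊆us (subst (λ t → (x ∷ D) ⊆ take (j ∸ length us) t)
                                (drop-++-length us _) xD⊆))

      right : (C ++ x ∷ D) ⊆ segOC T j (length T)
      right = subst ((C ++ x ∷ D) ⊆_) (sym (seg-to-end T j))
                (subst (λ t → (C ++ x ∷ D) ⊆ drop j t) (++-assoc us (x ∷ vs) ws)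
                  (⊆-trans CxD⊆ws (⊆-drop-++ j (us ++ x ∷ vs) j≤)))

  unextendable : ∀ {S₁ S₂ C D : List A} {y} → MaxCommonSubseq S₁ S₂ C → C ⊆ D →
                 ¬ CommonSubseq S₁ S₂ (y ∷ D)
  unextendable (_ , maximal) C⊆D yD-common
    with maximal _ yD-common (⊆-trans C⊆D (_ ∷ʳ ⊆-refl))
  ... | refl = <-irrefl refl (length-mono-≤ C⊆D)

module Counting {A : Set} (σ : A) where

  -- Count xs n: σ occurs exactly n times in xs.  It is a relation because _≡ σ is not decidable.
  data Count : List A → ℕ → Set where
    []   : Count [] 0
    hit  : ∀ {xs n} → Count xs n → Count (σ ∷ xs) (suc n)
    miss : ∀ {x xs n} → x ≢ σ → Count xs n → Count (x ∷ xs) n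

  Count-functional : ∀ {xs m n} → Count xs m → Count xs n → m ≡ n
  Count-functional []           []            = refl
  Count-functional (hit p)      (hit q)       = cong suc (Count-functional p q)
  Count-functional (hit p)      (miss σ≢σ q)  = contradiction refl σ≢σ
  Count-functional (miss σ≢σ p) (hit q)       = contradiction refl σ≢σ
  Count-functional (miss _ p)   (miss _ q)    = Count-functional p q

  Count-++ : ∀ {xs ys m n} → Count xs m → Count ys n → Count (xs ++ ys) (m + n)
  Count-++ []         q = q
  Count-++ (hit p)    q = hit (Count-++ p q)
  Count-++ (miss x≢ p) q = miss x≢ (Count-++ p q)

  Count-++⁻ : ∀ xs {ys k} → Count (xs ++ ys) k →
              ∃₂ λ m n → Count xs m × Count ys n × k ≡ m + n
  Count-++⁻ []       p            = 0 , _ , [] , p , refl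
  Count-++⁻ (x ∷ xs) (hit p)      with Count-++⁻ xs p
  ... | m , n , pm , pn , refl = suc m , n , hit pm , pn , refl
  Count-++⁻ (x ∷ xs) (miss x≢ p)  with Count-++⁻ xs p
  ... | m , n , pm , pn , refl = m , n , miss x≢ pm , pn , refl

  Count-cancelˡ : ∀ {xs ys m n} → Count xs m → Count (xs ++ ys) (m + n) → Count ys n
  Count-cancelˡ {xs} {m = m} p pq with Count-++⁻ xs pq
  ... | m′ , n′ , pm′ , pn′ , eq rewrite Count-functional p pm′ =
    subst (Count _) (sym (+-cancelˡ-≡ m′ _ _ eq)) pn′

  Count-⊆ : ∀ {xs ys n} → xs ⊆ ys → Count ys n → ∃[ m ] (Count xs m × m ≤ n)
  Count-⊆ []         []          = 0 , [] , z≤n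
  Count-⊆ (_ ∷ʳ p)   (hit q)     with Count-⊆ p q
  ... | m , pm , m≤n = m , pm , m≤n⇒m≤1+n m≤n
  Count-⊆ (_ ∷ʳ p)   (miss _ q)  = Count-⊆ p q
  Count-⊆ (refl ∷ p) (hit q)     with Count-⊆ p q
  ... | m , pm , m≤n = suc m , hit pm , s≤s m≤n
  Count-⊆ (refl ∷ p) (miss x≢ q) with Count-⊆ p q
  ... | m , pm , m≤n = m , miss x≢ pm , m≤n

  Count-mono : ∀ {xs ys m n} → xs ⊆ ys → Count xs m → Count ys n → m ≤ n
  Count-mono xs⊆ys p q with Count-⊆ xs⊆ys q
  ... | m′ , p′ , m′≤n rewrite Count-functional p p′ = m′≤n

  Count-replicate : ∀ m → Count (replicate m σ) m
  Count-replicate zero    = []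
  Count-replicate (suc m) = hit (Count-replicate m)

  replicate-⊆⇒≤ : ∀ {m xs n} → replicate m σ ⊆ xs → Count xs n → m ≤ n
  replicate-⊆⇒≤ {m} σᵐ⊆xs = Count-mono σᵐ⊆xs (Count-replicate m)

  Count-none : ∀ {xs} → All (_≢ σ) xs → Count xs 0
  Count-none []          = []
  Count-none (x≢ ∷ none) = miss x≢ (Count-none none)

  split-first-σ : ∀ {xs k W ws} → Count xs k → W ⊆ xs → W ≡ σ ∷ ws →
                  ∃₂ λ u v → xs ≡ u ++ σ ∷ v × W ⊆ σ ∷ v
  split-first-σ (hit _)      W⊆ refl = [] , _ , refl , W⊆
  split-first-σ (miss x≢ p)  (refl ∷ _) refl = contradiction refl x≢
  split-first-σ (miss {x} _ p) (_ ∷ʳ W⊆) refl with split-first-σ p W⊆ refl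
  ... | u , v , refl , W⊆σv = x ∷ u , v , refl , W⊆σv

  starts-with-σ : ∀ {W R m} → W ⊆ σ ∷ R → Count (σ ∷ R) m → replicate m σ ⊆ W →
                  ∃[ W′ ] W ≡ σ ∷ W′
  starts-with-σ (refl ∷ _) _            _    = _ , refl
  starts-with-σ (_ ∷ʳ W⊆R) (hit p)      σᵐ⊆W =
    contradiction (replicate-⊆⇒≤ (⊆-trans σᵐ⊆W W⊆R) p) (<-irrefl refl)
  starts-with-σ (_ ∷ʳ _)   (miss σ≢σ _) _    = contradiction refl σ≢σ

  take-Count-< : ∀ {a b xs m n} → Count (take a xs) m → Count (take b xs) n → m < n → a < b
  take-Count-< {a} {b} pa pb m<n = ≰⇒> λ b≤a → <⇒≱ m<n (Count-mono (take⁺ b≤a) pb pa)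

module Occurrences {A : Set} (S : List A) (σ : A) (ℓ : ℕ) (i : ℕ → ℕ)
  (i-increasing : ∀ k → 1 ≤ k → k < ℓ → i k < i (suc k))
  (i-σ : ∀ k → 1 ≤ k → k ≤ ℓ → at S (i k) ≡ just σ)
  (σ-i : ∀ q → at S q ≡ just σ → ∃[ k ] (1 ≤ k × k ≤ ℓ × i k ≡ q)) where

  open Counting σ

  n : ℕ
  n = length S

  -- the 0-based index of the k-th σ: S ≡ take (p k) S ++ σ ∷ drop (i k) S for 1 ≤ k ≤ ℓ
  p : ℕ → ℕ
  p k = pred (i k)

  i≡suc-p : ∀ {k} → suc k ≤ ℓ → i (suc k) ≡ suc (p (suc k))
  i≡suc-p {k} k<ℓ with i (suc k) | i-σ (suc k) (s≤s z≤n) k<ℓ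
  ... | zero  | at≡ = contradiction at≡ (at-zero S)
  ... | suc _ | _   = refl

  drop-p : ∀ {k} → suc k ≤ ℓ → drop (p (suc k)) S ≡ σ ∷ drop (suc (p (suc k))) S
  drop-p {k} k<ℓ =
    at-drop S _ (subst (λ q → at S q ≡ just σ) (i≡suc-p k<ℓ) (i-σ (suc k) (s≤s z≤n) k<ℓ))

  i-mono-< : ∀ {m k} → m < k → suc k ≤ ℓ → i (suc m) < i (suc k)
  i-mono-< {m} {suc k} (s≤s m≤k) k<ℓ with m≤n⇒m<n∨m≡n m≤k
  ... | inj₁ m<k  = <-trans (i-mono-< m<k (<⇒≤ k<ℓ)) (i-increasing (suc k) (s≤s z≤n) k<ℓ)
  ... | inj₂ refl = i-increasing (suc k) (s≤s z≤n) k<ℓ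

  i-mono-≤ : ∀ {m k} → m ≤ k → suc k ≤ ℓ → i (suc m) ≤ i (suc k)
  i-mono-≤ m≤k k<ℓ with m≤n⇒m<n∨m≡n m≤k
  ... | inj₁ m<k  = <⇒≤ (i-mono-< m<k k<ℓ)
  ... | inj₂ refl = ≤-refl

  p-mono-< : ∀ {m k} → m < k → suc k ≤ ℓ → p (suc m) < p (suc k)
  p-mono-< m<k k<ℓ =
    ≤-pred (subst₂ _<_ (i≡suc-p (<-trans m<k k<ℓ)) (i≡suc-p k<ℓ) (i-mono-< m<k k<ℓ))

  σ-free-slice : ∀ {a d} → (∀ m → suc m ≤ ℓ → a < i (suc m) → a + d < i (suc m)) →
                 Count (take d (drop a S)) 0
  σ-free-slice {a} {d} beyond = Count-none (tabulate not-σ)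
    where
      not-σ : ∀ {x} → x ∈ take d (drop a S) → x ≢ σ
      not-σ x∈ refl with ∈-slice⇒at a d S x∈
      ... | q , q<d , at≡ with σ-i _ at≡
      ... | zero  , ()  , _    , _
      ... | suc m , _   , m<ℓ , i≡ = <⇒≱ (+-monoʳ-< a q<d) (≤-pred (subst (a + d <_) i≡ a+d<i))
        where
          a+d<i : a + d < i (suc m)
          a+d<i = beyond m m<ℓ (subst (a <_) (sym i≡) (s≤s (m≤m+n a q)))

  segCO-i : ∀ {k} → suc k ≤ ℓ →
            segCO S (i 1) (i (suc k)) ≡ take (p (suc k) ∸ p 1) (drop (p 1) S)
  segCO-i k<ℓ = cong₂ (segCO S) (i≡suc-p (≤-trans (s≤s z≤n) k<ℓ)) (i≡suc-p k<ℓ)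

  seg-i-to-end : ∀ {k} → suc k ≤ ℓ → seg S (i (suc k)) n ≡ drop (p (suc k)) S
  seg-i-to-end {k} k<ℓ = trans (cong (λ a → seg S a n) (i≡suc-p k<ℓ)) (seg-to-end S (p (suc k)))

  count-before : ∀ {k} → suc k ≤ ℓ → Count (take (p (suc k)) S) k
  count-before {zero} 0<ℓ = σ-free-slice λ m m<ℓ _ →
    ≤-trans (≤-reflexive (sym (i≡suc-p 0<ℓ))) (i-mono-≤ z≤n m<ℓ)
  count-before {suc k} k+1<ℓ =
    subst (λ t → Count t (suc k)) (sym (take-through _ (drop-p k<ℓ) pk<pk+1))
      (subst (Count _) (+-comm k 1) (Count-++ (count-before k<ℓ) (hit (σ-free-slice beyond))))
    where
      k<ℓ : suc k ≤ ℓ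
      k<ℓ = <⇒≤ k+1<ℓ
      pk<pk+1 : p (suc k) < p (suc (suc k))
      pk<pk+1 = p-mono-< ≤-refl k+1<ℓ
      beyond : ∀ m → suc m ≤ ℓ → suc (p (suc k)) < i (suc m) →
               suc (p (suc k)) + (p (suc (suc k)) ∸ suc (p (suc k))) < i (suc m)
      beyond m m<ℓ after-k rewrite m+[n∸m]≡n pk<pk+1 =
        ≤-trans (≤-reflexive (sym (i≡suc-p k+1<ℓ))) (i-mono-≤ k<m m<ℓ)
        where
          k<m : suc k ≤ m
          k<m = ≰⇒> λ m≤k →
                  <⇒≱ (subst (_< i (suc m)) (sym (i≡suc-p k<ℓ)) after-k) (i-mono-≤ m≤k k<ℓ)

  count-all : 1 ≤ ℓ → Count S ℓ
  count-all 0<ℓ = subst₂ Count S≡ (trans (+-comm k 1) last) (Count-++ (count-before k<ℓ) (hit after-last))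
    where
      k = pred ℓ
      last : suc k ≡ ℓ
      last = suc-pred ℓ {{>-nonZero 0<ℓ}}
      k<ℓ : suc k ≤ ℓ
      k<ℓ = ≤-reflexive last
      S≡ : take (p (suc k)) S ++ σ ∷ drop (suc (p (suc k))) S ≡ S
      S≡ = trans (cong (take (p (suc k)) S ++_) (sym (drop-p k<ℓ))) (take++drop≡id (p (suc k)) S)
      a = suc (p (suc k))
      beyond : ∀ m → suc m ≤ ℓ → a < i (suc m) → a + (n ∸ a) < i (suc m)
      beyond m m<ℓ a<i = contradiction (i-mono-≤ (≤-pred (subst (suc m ≤_) (sym last) m<ℓ)) k<ℓ)
                           (<⇒≱ (subst (_< i (suc m)) (sym (i≡suc-p k<ℓ)) a<i))
      after-last : Count (drop a S) 0
      after-last = subst (λ t → Count t 0) (seg-to-end S a) (σ-free-slice beyond)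

  count-through : ∀ {k} → suc k ≤ ℓ → Count (take (i (suc k)) S) (suc k)
  count-through {k} k<ℓ =
    subst (λ t → Count t (suc k)) (sym prefix≡)
      (subst (Count _) (+-comm k 1) (Count-++ (count-before k<ℓ) (hit empty)))
    where
      rest = drop (suc (p (suc k))) S
      prefix≡ : take (i (suc k)) S ≡ take (p (suc k)) S ++ σ ∷ take (p (suc k) ∸ p (suc k)) rest
      prefix≡ = trans (cong (λ q → take q S) (i≡suc-p k<ℓ)) (take-through _ (drop-p k<ℓ) ≤-refl)
      empty : Count (take (p (suc k) ∸ p (suc k)) rest) 0
      empty = subst (λ d → Count (take d rest) 0) (sym (n∸n≡0 (p (suc k)))) []

  occurrence-index : ∀ {U V c} → S ≡ U ++ σ ∷ V → Count U c →
                     suc c ≤ ℓ × i (suc c) ≡ suc (length U)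
  occurrence-index {U} {V} {c} S≡ #U
    with σ-i _ (subst (λ T → at T (suc (length U)) ≡ just σ) (sym S≡) (at-++-length U))
  ... | zero  , () , _   , _
  ... | suc k , _  , k<ℓ , i≡ = subst (λ m → suc m ≤ ℓ × i (suc m) ≡ suc (length U)) k≡c (k<ℓ , i≡)
    where
      prefix : take (p (suc k)) S ≡ U
      prefix = trans (cong (λ q → take (pred q) S) i≡)
                 (trans (cong (take (length U)) S≡) (take-++-length U _))
      k≡c : k ≡ c
      k≡c = Count-functional (subst (λ T → Count T k) prefix (count-before k<ℓ)) #U

  segCO-from-first : ∀ {k} → 1 ≤ k → suc k ≤ ℓ →
                     ∃[ R ] (segCO S (i 1) (i (suc k)) ≡ σ ∷ R × Count (σ ∷ R) k)
  segCO-from-first {suc k} _ k<ℓ = R , segCO≡ , Count-cancelˡ (count-before 0<ℓ) #prefix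
    where
      0<ℓ : 1 ≤ ℓ
      0<ℓ = ≤-trans (s≤s z≤n) k<ℓ
      p1<pk : p 1 < p (suc (suc k))
      p1<pk = p-mono-< (s≤s z≤n) k<ℓ
      R = take (p (suc (suc k)) ∸ suc (p 1)) (drop (suc (p 1)) S)
      segCO≡ : segCO S (i 1) (i (suc (suc k))) ≡ σ ∷ R
      segCO≡ = trans (segCO-i k<ℓ) (slice-through _ (drop-p 0<ℓ) p1<pk)
      #prefix : Count (take (p 1) S ++ σ ∷ R) (suc k)
      #prefix = subst (λ T → Count T (suc k)) (take-through _ (drop-p 0<ℓ) p1<pk)
                  (count-before k<ℓ)

  seg-from-occurrence : ∀ {k m} → suc k ≤ ℓ → k + m ≡ ℓ →
                        ∃[ R ] (seg S (i (suc k)) n ≡ σ ∷ R × Count (σ ∷ R) m)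
  seg-from-occurrence {k} {m} k<ℓ k+m≡ℓ =
    _ , trans (seg-i-to-end k<ℓ) (drop-p k<ℓ) , subst (λ T → Count T m) (drop-p k<ℓ) #suffix
    where
      #S : Count (take (p (suc k)) S ++ drop (p (suc k)) S) (k + m)
      #S = subst₂ Count (sym (take++drop≡id (p (suc k)) S)) (sym k+m≡ℓ)
             (count-all (≤-trans (s≤s z≤n) k<ℓ))
      #suffix : Count (drop (p (suc k)) S) m
      #suffix = Count-cancelˡ (count-before k<ℓ) #S

  around-occurrence : ∀ {P₁ P₂ Q₁ Q₂ c₁ c d} → S ≡ (P₁ ++ σ ∷ P₂) ++ (Q₁ ++ σ ∷ Q₂) →
    Count P₁ c₁ → Count (P₁ ++ σ ∷ P₂) c → Count Q₁ d →
    (σ ∷ P₂) ⊆ segCO S (i 1) (i (suc c)) × (σ ∷ Q₂) ⊆ seg S (i (suc c)) n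
  around-occurrence {P₁} {P₂} {Q₁} {Q₂} {c₁} {c} {d} S≡ #P₁ #P #Q₁ = left , right
    where
      P = P₁ ++ σ ∷ P₂
      at-P₁ : suc c₁ ≤ ℓ × i (suc c₁) ≡ suc (length P₁)
      at-P₁ = occurrence-index (trans S≡ (++-assoc P₁ (σ ∷ P₂) _)) #P₁
      at-Q₁ : suc (c + d) ≤ ℓ × i (suc (c + d)) ≡ suc (length (P ++ Q₁))
      at-Q₁ = occurrence-index (trans S≡ (sym (++-assoc P Q₁ (σ ∷ Q₂)))) (Count-++ #P #Q₁)
      c<ℓ : suc c ≤ ℓ
      c<ℓ = ≤-trans (s≤s (m≤m+n c d)) (proj₁ at-Q₁)
      0<ℓ : 1 ≤ ℓ
      0<ℓ = ≤-trans (s≤s z≤n) c<ℓ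
      p1≤P₁ : p 1 ≤ length P₁
      p1≤P₁ = ≤-pred (subst₂ _≤_ (i≡suc-p 0<ℓ) (proj₂ at-P₁) (i-mono-≤ z≤n (proj₁ at-P₁)))
      P≤pc : length P ≤ p (suc c)
      P≤pc = ≤-pred (subst (length P <_) (i≡suc-p c<ℓ) (take-Count-< #prefix (count-through c<ℓ) ≤-refl))
        where
          #prefix : Count (take (length P) S) c
          #prefix = subst (λ T → Count T c)
                      (sym (trans (cong (take (length P)) S≡) (take-++-length P _))) #P
      pc≤PQ₁ : p (suc c) ≤ length (P ++ Q₁)
      pc≤PQ₁ = ≤-pred (subst₂ _≤_ (i≡suc-p c<ℓ) (proj₂ at-Q₁) (i-mono-≤ (m≤m+n c d) (proj₁ at-Q₁)))
      left : (σ ∷ P₂) ⊆ segCO S (i 1) (i (suc c))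
      left = subst ((σ ∷ P₂) ⊆_) (sym (segCO-i c<ℓ))
               (subst (λ T → (σ ∷ P₂) ⊆ take (p (suc c) ∸ p 1) (drop (p 1) T))
                      (sym (trans S≡ (++-assoc P₁ _ _)))
                 (⊆-slice (p 1) (p (suc c)) P₁ (σ ∷ P₂) (Q₁ ++ σ ∷ Q₂) p1≤P₁ P≤pc))
      right : (σ ∷ Q₂) ⊆ seg S (i (suc c)) n
      right = subst ((σ ∷ Q₂) ⊆_) (sym (seg-i-to-end c<ℓ))
                (subst (λ T → (σ ∷ Q₂) ⊆ drop (p (suc c)) T)
                       (sym (trans S≡ (sym (++-assoc P Q₁ _))))
                  (⊆-drop-++ (p (suc c)) (P ++ Q₁) pc≤PQ₁))

  cut-at-occurrence : ∀ {P₁ P₂ Q C W c j} → S ≡ P₁ ++ (σ ∷ P₂) ++ Q → Count P₁ c →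
    C ⊆ P₁ → W ⊆ P₂ → (C ++ σ ∷ W) ⊆ Q → SmallestEnd S (i (suc c)) (σ ∷ W) j →
    CommonSubseq (seg S 1 j) (segOC S j n) (C ++ σ ∷ W)
  cut-at-occurrence {P₁} {P₂} {Q} {C} {W} {c} {j} S≡ #P₁ C⊆P₁ W⊆P₂ CσW⊆Q end =
    subst (λ T → CommonSubseq (seg T 1 j) (segOC T j (length T)) (C ++ σ ∷ W)) (sym S≡)
      (SmallestEnd-split P₁ P₂ Q C⊆P₁ W⊆P₂ CσW⊆Q
        (subst₂ (λ T a → SmallestEnd T a (σ ∷ W) j) S≡ (proj₂ (occurrence-index S≡ #P₁)) end))

m≤c≤m+r⇒c≡m∨c≡1+m : ∀ {m c r} → m ≤ c → c ≤ m + r → r ≤ 1 →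
                     c ≡ m ⊎ (c ≡ suc m × r ≡ 1)
m≤c≤m+r⇒c≡m∨c≡1+m {m} {c} {zero} m≤c c≤m+0 _ =
  inj₁ (≤-antisym (subst (c ≤_) (+-identityʳ m) c≤m+0) m≤c)
m≤c≤m+r⇒c≡m∨c≡1+m {m} {c} {suc zero} m≤c c≤m+1 _ with m≤n⇒m<n∨m≡n m≤c
... | inj₁ m<c = inj₂ (≤-antisym (subst (c ≤_) (+-comm m 1) c≤m+1) m<c , refl)
... | inj₂ m≡c = inj₁ (sym m≡c)
m≤c≤m+r⇒c≡m∨c≡1+m {r = suc (suc _)} _ _ (s≤s ())

half-positive : ∀ {ℓ r e} → 2 ≤ ℓ → ℓ ≡ r + (e + e) → r ≤ 1 → 1 ≤ e
half-positive {e = suc _} _ _ _ = s≤s z≤n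
half-positive {r = r} {e = zero} 2≤ℓ refl r≤1 =
  contradiction (≤-trans 2≤ℓ (subst (_≤ 1) (sym (+-identityʳ r)) r≤1)) λ { (s≤s ()) }

square-count-bounds : ∀ {ℓ r e c₁ c₂ c′} → ℓ ≡ r + (e + e) → ℓ ≡ (c₁ + c₂) + c′ →
                      e ≤ c₂ → e ≤ c′ → c₁ ≤ r × e ≤ c₁ + c₂ × c₁ + c₂ ≤ e + r
square-count-bounds {ℓ} {r} {e} {c₁} {c₂} {c′} ℓ≡r+2e ℓ≡ e≤c₂ e≤c′ =
  +-cancelʳ-≤ (e + e) c₁ r (begin
    c₁ + (e + e)   ≤⟨ +-monoʳ-≤ c₁ (+-mono-≤ e≤c₂ e≤c′) ⟩
    c₁ + (c₂ + c′) ≡⟨ sym (+-assoc c₁ c₂ c′) ⟩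
    c₁ + c₂ + c′   ≡⟨ trans (sym ℓ≡) ℓ≡r+2e ⟩
    r + (e + e)    ∎) ,
  ≤-trans e≤c₂ (m≤n+m c₂ c₁) ,
  +-cancelʳ-≤ e (c₁ + c₂) (e + r) (begin
    c₁ + c₂ + e    ≤⟨ +-monoʳ-≤ (c₁ + c₂) e≤c′ ⟩
    c₁ + c₂ + c′   ≡⟨ trans (sym ℓ≡) ℓ≡r+2e ⟩
    r + (e + e)    ≡⟨ sym (+-assoc r e e) ⟩
    r + e + e      ≡⟨ cong (_+ e) (+-comm r e) ⟩
    e + r + e      ∎)
  where open ≤-Reasoning

module Square {A : Set} (S : List A) (σ : A) (ℓ : ℕ) (i : ℕ → ℕ)
  (i-increasing : ∀ k → 1 ≤ k → k < ℓ → i k < i (suc k))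
  (i-σ : ∀ k → 1 ≤ k → k ≤ ℓ → at S (i k) ≡ just σ)
  (σ-i : ∀ q → at S q ≡ just σ → ∃[ k ] (1 ≤ k × k ≤ ℓ × i k ≡ q))
  (e r : ℕ) (ℓ≡r+2e : ℓ ≡ r + (e + e)) (r≤1 : r ≤ 1) (1≤e : 1 ≤ e) where

  open Counting σ
  open Occurrences S σ ℓ i i-increasing i-σ σ-i

  CommonAtOcc MaxCommonAtOcc CommonAtPos MaxCommonAtPos : ℕ → List A → Set
  CommonAtOcc    k = CommonSubseq    (segCO S (i 1) (i k)) (seg S (i k) n)
  MaxCommonAtOcc k = MaxCommonSubseq (segCO S (i 1) (i k)) (seg S (i k) n)
  CommonAtPos    j = CommonSubseq    (seg S 1 j) (segOC S j n)
  MaxCommonAtPos j = MaxCommonSubseq (seg S 1 j) (segOC S j n)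

  0<ℓ : 1 ≤ ℓ
  0<ℓ = subst (1 ≤_) (sym ℓ≡r+2e) (≤-trans 1≤e (≤-trans (m≤m+n e e) (m≤n+m (e + e) r)))

  e<ℓ : suc e ≤ ℓ
  e<ℓ = subst (suc e ≤_) (sym ℓ≡r+2e) (≤-trans (+-monoˡ-≤ e 1≤e) (m≤n+m (e + e) r))

  ℓ≡1+2e : r ≡ 1 → suc e + e ≡ ℓ
  ℓ≡1+2e r≡1 = sym (trans ℓ≡r+2e (cong (_+ (e + e)) r≡1))

  σᵉ-leads-left : ∀ {W} → replicate e σ ⊆ W → W ⊆ segCO S (i 1) (i (suc e)) →
                  ∃[ W′ ] W ≡ σ ∷ W′
  σᵉ-leads-left {W} σᵉ⊆W W⊆ with segCO-from-first 1≤e e<ℓ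
  ... | R , seg≡ , #σR = starts-with-σ (subst (W ⊆_) seg≡ W⊆) #σR σᵉ⊆W

  σᵉ-leads-right : ∀ {W} → r ≡ 1 → replicate e σ ⊆ W → W ⊆ seg S (i (suc (suc e))) n →
                   ∃[ W′ ] W ≡ σ ∷ W′
  σᵉ-leads-right {W} r≡1 σᵉ⊆W W⊆
    with seg-from-occurrence (subst (suc (suc e) ≤_) (ℓ≡1+2e r≡1) (s≤s (+-monoˡ-≤ e 1≤e))) (ℓ≡1+2e r≡1)
  ... | R , seg≡ , #σR = starts-with-σ (subst (W ⊆_) seg≡ W⊆) #σR σᵉ⊆W

  module Choice (Y₀ Y : List A) (Y₀-max : MaxCommonAtOcc (suc e) Y₀) (σᵉ⊆Y₀ : replicate e σ ⊆ Y₀)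
    (Y-replaced : (r ≡ 1 × Y₀ ⊆ seg S (i (suc (suc e))) n) →
                  MaxCommonAtOcc (suc (suc e)) Y × Y₀ ⊆ Y)
    (Y-kept : ¬ (r ≡ 1 × Y₀ ⊆ seg S (i (suc (suc e))) n) → Y ≡ Y₀)
    (Y-replaced? : Dec (r ≡ 1 × Y₀ ⊆ seg S (i (suc (suc e))) n)) where

    Y₀⊆Y : Y₀ ⊆ Y
    Y₀⊆Y = case Y-replaced? of λ where
      (yes replaced) → proj₂ (Y-replaced replaced)
      (no  kept)     → ⊆-reflexive (sym (Y-kept kept))

    σᵉ⊆Y : replicate e σ ⊆ Y
    σᵉ⊆Y = ⊆-trans σᵉ⊆Y₀ Y₀⊆Y

    Y-head : ∃[ Y′ ] Y ≡ σ ∷ Y′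
    Y-head = case Y-replaced? of λ where
      (yes replaced) → σᵉ-leads-right (proj₁ replaced) σᵉ⊆Y
                         (proj₂ (proj₁ (proj₁ (Y-replaced replaced))))
      (no  kept)     → subst (λ T → ∃[ Y′ ] T ≡ σ ∷ Y′) (sym (Y-kept kept))
                         (σᵉ-leads-left σᵉ⊆Y₀ (proj₁ (proj₁ Y₀-max)))

    Y-maximal : ∀ {c W} → e ≤ c → c ≤ e + r → CommonAtOcc (suc c) W → Y ⊆ W → Y ≡ W
    Y-maximal e≤c c≤e+r W-common Y⊆W with m≤c≤m+r⇒c≡m∨c≡1+m e≤c c≤e+r r≤1
    ... | inj₁ refl =
      ⊆-antisym Y⊆W (subst (_⊆ Y) (sym (proj₂ Y₀-max _ W-common (⊆-trans Y₀⊆Y Y⊆W))) Y₀⊆Y)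
    ... | inj₂ (refl , r≡1) = sym (proj₂ (proj₁ (Y-replaced replaced)) _ W-common Y⊆W)
      where replaced = r≡1 , ⊆-trans (⊆-trans Y₀⊆Y Y⊆W) (proj₂ W-common)

    cut-from-decomposition : ∀ {y Z′ Z″ P₁ P₂ Q₁ Q₂} → S ≡ (P₁ ++ σ ∷ P₂) ++ (Q₁ ++ σ ∷ Q₂) →
      Y ⊆ σ ∷ Z″ → (y ∷ Z′) ⊆ P₁ → Z″ ⊆ P₂ → (y ∷ Z′ ++ σ ∷ Z″) ⊆ (Q₁ ++ σ ∷ Q₂) → Z″ ⊆ Q₂ →
      ∃[ c ] (c ≤ r × ∀ j → SmallestEnd S (i (suc c)) Y j →
                            CommonAtPos j (y ∷ Z′ ++ σ ∷ Z″))
    cut-from-decomposition {y} {Z′} {Z″} {P₁} {P₂} {Q₁} S≡ Y⊆σZ″ yZ′⊆P₁ Z″⊆P₂ yZ⊆Q Z″⊆Q₂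
      with Count-++⁻ (P₁ ++ σ ∷ P₂) (subst (λ T → Count T ℓ) S≡ (count-all 0<ℓ))
    ... | cP , cQ , #P , #Q , ℓ≡cP+cQ with Count-++⁻ P₁ #P | Count-++⁻ Q₁ #Q
    ... | c₁ , c₂ , #P₁ , #σP₂ , refl | d , _ , #Q₁ , _ , _
      with square-count-bounds ℓ≡r+2e ℓ≡cP+cQ
             (replicate-⊆⇒≤ (⊆-trans σᵉ⊆Y (⊆-trans Y⊆σZ″ (refl ∷ Z″⊆P₂))) #σP₂)
             (replicate-⊆⇒≤ (⊆-trans σᵉ⊆Y (⊆-trans Y⊆σZ″ (⊆-trans (++⁺ˡ (y ∷ Z′) ⊆-refl) yZ⊆Q)))
                            #Q)
    ... | c₁≤r , e≤cP , cP≤e+r = c₁ , c₁≤r , λ j end →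
      cut-at-occurrence (trans S≡ (++-assoc P₁ (σ ∷ P₂) _)) #P₁ yZ′⊆P₁ Z″⊆P₂ yZ⊆Q
        (subst (λ W → SmallestEnd S (i (suc c₁)) W j) Y≡σZ″ end)
      where
        around = around-occurrence S≡ #P₁ #P #Q₁
        Y≡σZ″ : Y ≡ σ ∷ Z″
        Y≡σZ″ = Y-maximal e≤cP cP≤e+r
                  (⊆-trans (refl ∷ Z″⊆P₂) (proj₁ around) , ⊆-trans (refl ∷ Z″⊆Q₂) (proj₂ around)) Y⊆σZ″

    square-cut : ∀ {y Z} → Y ⊆ Z → ((y ∷ Z) ++ (y ∷ Z)) ⊆ S →
                 ∃[ c ] (c ≤ r × ∀ j → SmallestEnd S (i (suc c)) Y j → CommonAtPos j (y ∷ Z))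
    square-cut {y} {Z} Y⊆Z yZyZ⊆S
      with Count-⊆ (∷ˡ⁻ (⊆-trans (++⁺ʳ (y ∷ Z) ⊆-refl) yZyZ⊆S)) (count-all 0<ℓ)
    ... | _ , #Z , _ with split-first-σ #Z Y⊆Z (proj₂ Y-head)
    ... | Z′ , Z″ , refl , Y⊆σZ″ with ++-⊆-split (y ∷ Z′ ++ σ ∷ Z″) yZyZ⊆S
    ... | P , Q , S≡PQ , yZ⊆P , yZ⊆Q with ++∷-⊆-split (y ∷ Z′) yZ⊆P | ++∷-⊆-split (y ∷ Z′) yZ⊆Q
    ... | P₁ , P₂ , refl , yZ′⊆P₁ , Z″⊆P₂ | Q₁ , Q₂ , refl , _ , Z″⊆Q₂ =
      cut-from-decomposition S≡PQ Y⊆σZ″ yZ′⊆P₁ Z″⊆P₂ yZ⊆Q Z″⊆Q₂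

    module _ (j₁ : ℕ) (j₁-end : SmallestEnd S (i 1) Y j₁) (Z₀ Z : List A)
      (Z₀-max : MaxCommonAtPos j₁ Z₀) (Y⊆Z₀ : Y ⊆ Z₀)
      (j₂ : ℕ) (j₂-end : r ≡ 1 → SmallestEnd S (i 2) Y j₂)
      (Z-replaced : (r ≡ 1 × Z₀ ⊆ segOC S j₂ n) → MaxCommonAtPos j₂ Z × Z₀ ⊆ Z)
      (Z-kept : ¬ (r ≡ 1 × Z₀ ⊆ segOC S j₂ n) → Z ≡ Z₀)
      (Z-replaced? : Dec (r ≡ 1 × Z₀ ⊆ segOC S j₂ n)) where

      Z₀⊆Z : Z₀ ⊆ Z
      Z₀⊆Z = case Z-replaced? of λ where
        (yes replaced) → proj₂ (Z-replaced replaced)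
        (no  kept)     → ⊆-reflexive (sym (Z-kept kept))

      Z-unextendable : ∀ {c y} → c ≤ r →
                       ¬ (∀ j → SmallestEnd S (i (suc c)) Y j → CommonAtPos j (y ∷ Z))
      Z-unextendable c≤r cut with m≤c≤m+r⇒c≡m∨c≡1+m z≤n c≤r r≤1
      ... | inj₁ refl = unextendable Z₀-max Z₀⊆Z (cut j₁ j₁-end)
      ... | inj₂ (refl , r≡1) = unextendable (proj₁ (Z-replaced replaced)) ⊆-refl yZ-common
        where
          yZ-common = cut j₂ (j₂-end r≡1)
          replaced = r≡1 , ⊆-trans Z₀⊆Z (⊆-trans (_ ∷ʳ ⊆-refl) (proj₂ yZ-common))

      not-left-extendable : ¬ LeftExtendable S Z
      not-left-extendable (y , yZyZ⊆S) with square-cut (⊆-trans Y⊆Z₀ Z₀⊆Z) yZyZ⊆S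
      ... | c , c≤r , cut = Z-unextendable c≤r cut

lemma5 : {A : Set} (S : List A) →
  -- every character of S occurs at least twice
  (∀ c p → at S p ≡ just c → ∃[ q ] (q ≢ p × at S q ≡ just c)) →
  (σ : A) (ℓ : ℕ) → 2 ≤ ℓ →
  -- i₁ < ⋯ < i_ℓ are exactly the positions of σ in S
  (i : ℕ → ℕ) →
  (∀ k → 1 ≤ k → k < ℓ → i k < i (suc k)) →
  (∀ k → 1 ≤ k → k ≤ ℓ → at S (i k) ≡ just σ) →
  (∀ p → at S p ≡ just σ → ∃[ k ] (1 ≤ k × k ≤ ℓ × i k ≡ p)) →
  let n = length S
      e = ℓ / 2 in
  -- first choice of Y, then possible replacement
  (Y₀ Y : List A) →
  MaxCommonSubseq (segCO S (i 1) (i (suc e))) (seg S (i (suc e)) n) Y₀ →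
  Subseq (replicate e σ) Y₀ →
  ((ℓ % 2 ≡ 1 × Subseq Y₀ (seg S (i (suc (suc e))) n)) →
     MaxCommonSubseq (segCO S (i 1) (i (suc (suc e)))) (seg S (i (suc (suc e))) n) Y × Subseq Y₀ Y) →
  (¬ (ℓ % 2 ≡ 1 × Subseq Y₀ (seg S (i (suc (suc e))) n)) → Y ≡ Y₀) →
  -- j₁ and first choice of Z
  (j₁ : ℕ) → SmallestEnd S (i 1) Y j₁ →
  (Z₀ Z : List A) →
  MaxCommonSubseq (seg S 1 j₁) (segOC S j₁ n) Z₀ →
  Subseq Y Z₀ →
  -- j₂ (only constrained when ℓ is odd) and possible replacement of Z
  (j₂ : ℕ) → (ℓ % 2 ≡ 1 → SmallestEnd S (i 2) Y j₂) →
  ((ℓ % 2 ≡ 1 × Subseq Z₀ (segOC S j₂ n)) →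
     MaxCommonSubseq (seg S 1 j₂) (segOC S j₂ n) Z × Subseq Z₀ Z) →
  (¬ (ℓ % 2 ≡ 1 × Subseq Z₀ (segOC S j₂ n)) → Z ≡ Z₀) →
  ¬ LeftExtendable S Z
-- Whether Y and Z were replaced
-- is not decidable, but the goal is a negation, so we may decide it classically.
lemma5 S _ σ ℓ 2≤ℓ i i-increasing i-σ σ-i Y₀ Y Y₀-max σᵉ⊆Y₀ Y-replaced Y-kept
       j₁ j₁-end Z₀ Z Z₀-max Y⊆Z₀ j₂ j₂-end Z-replaced Z-kept yZyZ⊆S =
  ¬¬-excluded-middle λ Y-replaced? → ¬¬-excluded-middle λ Z-replaced? →
    not-left-extendable Y₀ Y Y₀-max σᵉ⊆Y₀ Y-replaced Y-kept Y-replaced?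
      j₁ j₁-end Z₀ Z Z₀-max Y⊆Z₀ j₂ j₂-end Z-replaced Z-kept Z-replaced? yZyZ⊆S
  where
    e = ℓ / 2
    r = ℓ % 2
    ℓ≡r+2e : ℓ ≡ r + (e + e)
    ℓ≡r+2e = trans (m≡m%n+[m/n]*n ℓ 2)
               (cong (r +_) (trans (*-comm e 2) (cong (e +_) (+-identityʳ e))))
    r≤1 : r ≤ 1
    r≤1 = ≤-pred (m%n<n ℓ 2)
    open Square S σ ℓ i i-increasing i-σ σ-i e r ℓ≡r+2e r≤1 (half-positive 2≤ℓ ℓ≡r+2e r≤1)
    open Choice
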